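{- For a network game with players $V$, network $N=(V,L)$ and potential matching edges $E$, consider the polytope in variables $x_e$ ($e\in E$) and $x_v$ ($v\in V$) given by $$\sum_{e\in E,\, v\in e} x_e + x_v = 1\quad \forall v\in V,$$ $$\sum_{\substack{e'=\{u',v'\}\in E\\ u'\prec_{v'}u}} x_{e'} + x_{v'} + x_e \le 1\quad \forall v'\in V,\ e=\{u,v\}\in E \text{ with } \{u,v'\}\in E,\ v\prec_u v',\ \mathrm{dist}(u,v',N_e)\le 2,$$ $$\sum_{\substack{e'=\{u',v'\}\in E\\ u'\prec_{v'}u}} x_{e'} + x_{v'} + x_u \le 1\quad \forall v',u\in V \text{ with } \{u,v'\}\in E,\ \mathrm{dist}(u,v',N)\le 2,$$ $$x_e\ge 0,\ x_v\ge 0\quad\forall e\in E,\ v\in V.$$ The incidence vectors of locally stable matchings are precisely the integer solutions of this polytope.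
   Context: A network game consists of a set $V$ of players, a network $N=(V,L)$ of links, and a set $E$ of potential matching edges; a state is a matching $M\subseteq E$. Each player $v$ has a strict preference order over its possible partners (those $w$ with $\{v,w\}\in E$), written $a\prec_v b$ if $v$ strictly prefers $b$ to $a$, and prefers being matched to being unmatched. In state $M$, two players are accessible if their distance in $(V,L\cup M)$ is at most $2$. A local blocking pair is a pair $\{u,v\}\in E$ of accessible players each of which is unmatched or strictly prefers the other to its current partner; a locally stable matching is a matching with no local blocking pair. For $e\in E$, $N_e=(V,L\cup\{e\})$, and $\mathrm{dist}(\cdot,\cdot,H)$ is the hop distance in graph $H$. The incidence vector $x$ of a matching $M$ has $x_e=1$ for $e\in M$, $x_v=1$ for players $v$ unmatched in $M$, and all other entries $0$. -}

module Defs where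

open import Data.Nat using (ℕ; _<ᵇ_)
open import Data.Fin using (Fin; zero; suc; _≟_)
open import Data.Bool using (Bool; true; false; if_then_else_; _∨_; _∧_)
open import Data.Integer using (ℤ; 0ℤ; 1ℤ; _+_; _≤_)
open import Data.Product using (Σ; ∃; _×_; _,_; proj₁; proj₂)
open import Data.Sum using (_⊎_)
open import Relation.Nullary using (¬_)
open import Relation.Nullary.Decidable using (⌊_⌋)
open import Relation.Binary.PropositionalEquality using (_≡_; _≢_)

SamePair : ∀ {n} → Fin n × Fin n → Fin n × Fin n → Set
SamePair (a , b) (c , d) = (a ≡ c × b ≡ d) ⊎ (a ≡ d × b ≡ c)

-- L is the (undirected) link relation of the network N = (V,L)
-- (symmetry is built in through Adj below).  ends e gives the two endpoints of
-- the potential matching edge e ∈ E.  Preferences: rank v w ∈ ℕ, where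
-- a ≺_v b  (v strictly prefers b to a)  iff  rank v a < rank v b;
-- rank v is injective on the possible partners of v, so ≺_v is a strict total order
-- on them.
record NetworkGame (n m : ℕ) : Set₁ where
  field
    L        : Fin n → Fin n → Set
    ends     : Fin m → Fin n × Fin n
    ends-distinct : ∀ e → proj₁ (ends e) ≢ proj₂ (ends e)
    ends-inj : ∀ e f → SamePair (ends e) (ends f) → e ≡ f
    rank     : Fin n → Fin n → ℕ

  InE : Fin n → Fin n → Set
  InE v w = ∃ λ e → SamePair (ends e) (v , w)

  field
    rank-inj : ∀ v a b → InE v a → InE v b → rank v a ≡ rank v b → a ≡ b

  _≺[_]_ : Fin n → Fin n → Fin n → Set
  a ≺[ v ] b = Data.Nat._<_ (rank v a) (rank v b)

  incident : Fin n → Fin m → Bool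
  incident v e = ⌊ v ≟ proj₁ (ends e) ⌋ ∨ ⌊ v ≟ proj₂ (ends e) ⌋

  -- the other endpoint of e, seen from v (meaningful when v ∈ e)
  other : Fin m → Fin n → Fin n
  other e v = if ⌊ v ≟ proj₁ (ends e) ⌋ then proj₂ (ends e) else proj₁ (ends e)

sumFin : ∀ {k} → (Fin k → ℤ) → ℤ
sumFin {ℕ.zero} f = 0ℤ
sumFin {ℕ.suc k} f = f zero + sumFin (λ i → f (suc i))

Within2 : ∀ {n} → (Fin n → Fin n → Set) → Fin n → Fin n → Set
Within2 {n} A a b = a ≡ b ⊎ A a b ⊎ Σ (Fin n) (λ c → A a c × A c b)

module _ {n m : ℕ} (G : NetworkGame n m) where
  open NetworkGame G

  AdjN : Fin n → Fin n → Set
  AdjN a b = L a b ⊎ L b a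

  AdjNe : Fin m → Fin n → Fin n → Set
  AdjNe e a b = AdjN a b ⊎ SamePair (ends e) (a , b)

  State : Set
  State = Fin m → Bool

  AdjLM : State → Fin n → Fin n → Set
  AdjLM M a b = AdjN a b ⊎ ∃ λ f → M f ≡ true × SamePair (ends f) (a , b)

  IsMatching : State → Set
  IsMatching M = ∀ e f → M e ≡ true → M f ≡ true → e ≢ f →
                 ∀ v → incident v e ≡ true → incident v f ≡ false

  Unmatched : State → Fin n → Set
  Unmatched M v = ∀ f → M f ≡ true → incident v f ≡ false

  WantsToSwitch : State → Fin n → Fin n → Set
  WantsToSwitch M v w =
    Unmatched M v ⊎ (∃ λ f → M f ≡ true × incident v f ≡ true × (other f v ≺[ v ] w))

  Accessible : State → Fin n → Fin n → Set
  Accessible M = Within2 (AdjLM M)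

  LocalBlockingPair : State → Fin n → Fin n → Set
  LocalBlockingPair M u v =
    InE u v × Accessible M u v × WantsToSwitch M u v × WantsToSwitch M v u

  LocallyStable : State → Set
  LocallyStable M = IsMatching M × (∀ u v → ¬ LocalBlockingPair M u v)

  IsIncidenceVector : State → (Fin m → ℤ) → (Fin n → ℤ) → Set
  IsIncidenceVector M xE xV =
    (∀ e → xE e ≡ (if M e then 1ℤ else 0ℤ)) ×
    (∀ v → (Unmatched M v → xV v ≡ 1ℤ) × (¬ Unmatched M v → xV v ≡ 0ℤ))

  degSum : (Fin m → ℤ) → Fin n → ℤ
  degSum xE v = sumFin (λ e → if incident v e then xE e else 0ℤ)

  worseSum : (Fin m → ℤ) → Fin n → Fin n → ℤ
  worseSum xE v' u =
    sumFin (λ e' → if incident v' e' ∧ (rank v' (other e' v') <ᵇ rank v' u)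
                   then xE e' else 0ℤ)

  InPolytope : (Fin m → ℤ) → (Fin n → ℤ) → Set
  InPolytope xE xV =
    (∀ v → degSum xE v + xV v ≡ 1ℤ) ×
    (∀ v' e u v → SamePair (ends e) (u , v) → InE u v' → v ≺[ u ] v' →
       Within2 (AdjNe e) u v' →
       worseSum xE v' u + xV v' + xE e ≤ 1ℤ) ×
    (∀ v' u → InE u v' → Within2 AdjN u v' →
       worseSum xE v' u + xV v' + xV u ≤ 1ℤ) ×
    (∀ e → 0ℤ ≤ xE e) ×
    (∀ v → 0ℤ ≤ xV v)

-- The degree equations and nonnegativity force an integer point to be a 0/1
-- vector: the edges with x_e = 1 form a matching M and x_v = 1 exactly for the
-- players M leaves unmatched.  For such a point, worseSum v' u + x_{v'} is 1 when
-- v' would switch to u and 0 otherwise, while the extra term x_e (u matched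
-- along e to someone worse than v') or x_u (u unmatched) is 1 exactly when u
-- would switch to v'.  So an inequality is violated precisely at a local blocking
-- pair.  The distance conditions match accessibility because a path of length
-- at most 2 in L ∪ M uses at most one matching edge, and that edge contains one
-- of the two ends of the path.
module Submission where

open import Defs
open import Data.Nat using (ℕ; _<ᵇ_; s≤s; z≤n)
import Data.Nat.Properties as ℕ
open import Data.Fin using (Fin; zero; suc; _≟_)
import Data.Fin.Properties as Fin
open import Data.Bool using (true; false; if_then_else_; _∨_; _∧_)
import Data.Bool.Properties as Bool
open import Data.Integer using (ℤ; 0ℤ; 1ℤ; _+_; _≤_; +_; +≤+)
import Data.Integer.Properties as ℤ
open import Data.Product using (∃; _×_; _,_; proj₁; proj₂)
open import Data.Sum using (_⊎_; inj₁; inj₂)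
open import Data.Empty using (⊥-elim)
open import Relation.Nullary using (¬_; yes; no)
open import Relation.Nullary.Decidable using (⌊_⌋; _×-dec_)
open import Relation.Binary.PropositionalEquality
open import Function using (_∘_)
open import Function.Bundles using (_⇔_; mk⇔; module Equivalence)

i≤i+j : ∀ i {j} → 0ℤ ≤ j → i ≤ i + j
i≤i+j i {j} 0≤j = subst (_≤ i + j) (ℤ.+-identityʳ i) (ℤ.+-monoʳ-≤ i 0≤j)

i≤j+i : ∀ i {j} → 0ℤ ≤ j → i ≤ j + i
i≤j+i i {j} 0≤j = subst (_≤ j + i) (ℤ.+-identityˡ i) (ℤ.+-monoˡ-≤ i 0≤j)

1≤i⇒i+1≰1 : ∀ {i} → 1ℤ ≤ i → ¬ (i + 1ℤ ≤ 1ℤ)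
1≤i⇒i+1≰1 1≤i i+1≤1 with ℤ.≤-trans (ℤ.+-monoˡ-≤ 1ℤ 1≤i) i+1≤1
... | +≤+ (s≤s ())

0≤i≤1⇒i≡0⊎i≡1 : ∀ i → 0ℤ ≤ i → i ≤ 1ℤ → i ≡ 0ℤ ⊎ i ≡ 1ℤ
0≤i≤1⇒i≡0⊎i≡1 (+ 0) _ _ = inj₁ refl
0≤i≤1⇒i≡0⊎i≡1 (+ 1) _ _ = inj₂ refl
0≤i≤1⇒i≡0⊎i≡1 (+ ℕ.suc (ℕ.suc k)) _ (+≤+ (s≤s ()))

0≤i⇒1+i≤1⇒i≡0 : ∀ i → 0ℤ ≤ i → 1ℤ + i ≤ 1ℤ → i ≡ 0ℤ
0≤i⇒1+i≤1⇒i≡0 (+ 0) _ _ = refl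
0≤i⇒1+i≤1⇒i≡0 (+ ℕ.suc k) _ (+≤+ (s≤s ()))

if-nonneg : ∀ b {i} → 0ℤ ≤ i → 0ℤ ≤ (if b then i else 0ℤ)
if-nonneg true 0≤i = 0≤i
if-nonneg false _ = ℤ.≤-refl

if-≡0 : ∀ b {i} → i ≡ 0ℤ → (if b then i else 0ℤ) ≡ 0ℤ
if-≡0 true i≡0 = i≡0
if-≡0 false _ = refl

if-∧-≤ : ∀ b c {i} → 0ℤ ≤ i → (if b ∧ c then i else 0ℤ) ≤ (if b then i else 0ℤ)
if-∧-≤ false c _ = ℤ.≤-refl
if-∧-≤ true true _ = ℤ.≤-refl
if-∧-≤ true false 0≤i = 0≤i

sumFin-nonneg : ∀ {k} (f : Fin k → ℤ) → (∀ i → 0ℤ ≤ f i) → 0ℤ ≤ sumFin f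
sumFin-nonneg {ℕ.zero} f _ = ℤ.≤-refl
sumFin-nonneg {ℕ.suc k} f 0≤f = ℤ.+-mono-≤ (0≤f zero) (sumFin-nonneg (f ∘ suc) (0≤f ∘ suc))

sumFin-mono : ∀ {k} (f g : Fin k → ℤ) → (∀ i → f i ≤ g i) → sumFin f ≤ sumFin g
sumFin-mono {ℕ.zero} f g _ = ℤ.≤-refl
sumFin-mono {ℕ.suc k} f g f≤g = ℤ.+-mono-≤ (f≤g zero) (sumFin-mono (f ∘ suc) (g ∘ suc) (f≤g ∘ suc))

sumFin-zero : ∀ {k} (f : Fin k → ℤ) → (∀ i → f i ≡ 0ℤ) → sumFin f ≡ 0ℤ
sumFin-zero {ℕ.zero} f _ = refl
sumFin-zero {ℕ.suc k} f f≡0 = cong₂ _+_ (f≡0 zero) (sumFin-zero (f ∘ suc) (f≡0 ∘ suc))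

sumFin-single : ∀ {k} (f : Fin k → ℤ) i → (∀ j → j ≢ i → f j ≡ 0ℤ) → sumFin f ≡ f i
sumFin-single {ℕ.suc k} f zero f≡0 = begin
  f zero + sumFin (f ∘ suc) ≡⟨ cong (λ s → f zero + s) (sumFin-zero (f ∘ suc) tail≡0) ⟩
  f zero + 0ℤ               ≡⟨ ℤ.+-identityʳ (f zero) ⟩
  f zero                    ∎
  where
  open ≡-Reasoning
  tail≡0 : ∀ j → f (suc j) ≡ 0ℤ
  tail≡0 j = f≡0 (suc j) λ ()
sumFin-single {ℕ.suc k} f (suc i) f≡0 = begin
  f zero + sumFin (f ∘ suc) ≡⟨ cong₂ _+_ (f≡0 zero λ ()) (sumFin-single (f ∘ suc) i tail≡0) ⟩
  0ℤ + f (suc i)            ≡⟨ ℤ.+-identityˡ (f (suc i)) ⟩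
  f (suc i)                 ∎
  where
  open ≡-Reasoning
  tail≡0 : ∀ j → j ≢ i → f (suc j) ≡ 0ℤ
  tail≡0 j j≢i = f≡0 (suc j) (j≢i ∘ Fin.suc-injective)

term≤sumFin : ∀ {k} (f : Fin k → ℤ) → (∀ i → 0ℤ ≤ f i) → ∀ i → f i ≤ sumFin f
term≤sumFin f 0≤f zero = i≤i+j (f zero) (sumFin-nonneg (f ∘ suc) (0≤f ∘ suc))
term≤sumFin f 0≤f (suc i) =
  ℤ.≤-trans (term≤sumFin (f ∘ suc) (0≤f ∘ suc) i) (i≤j+i _ (0≤f zero))

two-terms≤sumFin : ∀ {k} (f : Fin k → ℤ) → (∀ i → 0ℤ ≤ f i) →
                   ∀ i j → i ≢ j → f i + f j ≤ sumFin f
two-terms≤sumFin f 0≤f zero zero 0≢0 = ⊥-elim (0≢0 refl)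
two-terms≤sumFin f 0≤f zero (suc j) _ =
  ℤ.+-monoʳ-≤ (f zero) (term≤sumFin (f ∘ suc) (0≤f ∘ suc) j)
two-terms≤sumFin f 0≤f (suc i) zero _ =
  subst (_≤ sumFin f) (ℤ.+-comm (f zero) (f (suc i)))
    (ℤ.+-monoʳ-≤ (f zero) (term≤sumFin (f ∘ suc) (0≤f ∘ suc) i))
two-terms≤sumFin f 0≤f (suc i) (suc j) i≢j =
  ℤ.≤-trans (two-terms≤sumFin (f ∘ suc) (0≤f ∘ suc) i j (i≢j ∘ cong suc)) (i≤j+i _ (0≤f zero))

SamePair-swap : ∀ {n} {p : Fin n × Fin n} {u v} → SamePair p (u , v) → SamePair p (v , u)
SamePair-swap (inj₁ (a , b)) = inj₂ (a , b)
SamePair-swap (inj₂ (a , b)) = inj₁ (a , b)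

Within2-map : ∀ {n} {A B : Fin n → Fin n → Set} → (∀ {a b} → A a b → B a b) →
              ∀ {x y} → Within2 A x y → Within2 B x y
Within2-map f (inj₁ x≡y) = inj₁ x≡y
Within2-map f (inj₂ (inj₁ a)) = inj₂ (inj₁ (f a))
Within2-map f (inj₂ (inj₂ (c , a , b))) = inj₂ (inj₂ (c , f a , f b))

Within2-sym : ∀ {n} {A : Fin n → Fin n → Set} → (∀ {a b} → A a b → A b a) →
              ∀ {x y} → Within2 A x y → Within2 A y x
Within2-sym sym-A (inj₁ x≡y) = inj₁ (sym x≡y)
Within2-sym sym-A (inj₂ (inj₁ a)) = inj₂ (inj₁ (sym-A a))
Within2-sym sym-A (inj₂ (inj₂ (c , a , b))) = inj₂ (inj₂ (c , sym-A b , sym-A a))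

module _ {n m : ℕ} (G : NetworkGame n m) where
  open NetworkGame G

  incident-end : ∀ e {u v} → SamePair (ends e) (u , v) → incident u e ≡ true
  incident-end e {u} (inj₁ (a≡u , _)) =
    cong (λ b → b ∨ ⌊ u ≟ proj₂ (ends e) ⌋) (cong ⌊_⌋ (≡-≟-identity _≟_ (sym a≡u)))
  incident-end e {u} (inj₂ (_ , b≡u)) =
    trans (cong (⌊ u ≟ proj₁ (ends e) ⌋ ∨_) (cong ⌊_⌋ (≡-≟-identity _≟_ (sym b≡u))))
          (Bool.∨-zeroʳ _)

  other-end : ∀ e {u v} → SamePair (ends e) (u , v) → other e u ≡ v
  other-end e {u} (inj₁ (a≡u , b≡v)) =
    trans (cong (λ b → if b then proj₂ (ends e) else proj₁ (ends e))
                (cong ⌊_⌋ (≡-≟-identity _≟_ (sym a≡u)))) b≡v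
  other-end e {u} (inj₂ (a≡v , b≡u)) =
    trans (cong (λ b → if b then proj₂ (ends e) else proj₁ (ends e))
                (cong ⌊_⌋ (≢-≟-identity _≟_ u≢a))) a≡v
    where
    u≢a : u ≢ proj₁ (ends e)
    u≢a u≡a = ends-distinct e (trans (sym u≡a) (sym b≡u))

  incident⇒SamePair : ∀ e {u} → incident u e ≡ true → SamePair (ends e) (u , other e u)
  incident⇒SamePair e {u} u∈e with u ≟ proj₁ (ends e) | u ≟ proj₂ (ends e)
  ... | yes u≡a | _     = inj₁ (sym u≡a , refl)
  ... | no _    | yes u≡b = inj₂ (refl , sym u≡b)

  InE-sym : ∀ {u v} → InE u v → InE v u
  InE-sym (e , uv) = e , SamePair-swap uv

  AdjNe-sym : ∀ e {a b} → AdjNe G e a b → AdjNe G e b a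
  AdjNe-sym e (inj₁ (inj₁ l)) = inj₁ (inj₂ l)
  AdjNe-sym e (inj₁ (inj₂ l)) = inj₁ (inj₁ l)
  AdjNe-sym e (inj₂ ab) = inj₂ (SamePair-swap ab)

  matched⊎unmatched : ∀ (M : State G) v →
    (∃ λ f → M f ≡ true × incident v f ≡ true) ⊎ Unmatched G M v
  matched⊎unmatched M v
    with Fin.any? (λ f → (M f Bool.≟ true) ×-dec (incident v f Bool.≟ true))
  ... | yes matched = inj₁ matched
  ... | no ¬matched = inj₂ unmatched
    where
    unmatched : Unmatched G M v
    unmatched f f∈M with incident v f in v∈f
    ... | true  = ⊥-elim (¬matched (f , f∈M , v∈f))
    ... | false = refl

  module _ {M : State G} (matching : IsMatching G M) where

    matched-edge-unique : ∀ {f g v} → M f ≡ true → M g ≡ true →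
                          incident v f ≡ true → incident v g ≡ true → f ≡ g
    matched-edge-unique {f} {g} {v} f∈M g∈M v∈f v∈g with f ≟ g
    ... | yes f≡g = f≡g
    ... | no f≢g with () ← trans (sym v∈g) (matching f g f∈M g∈M f≢g v v∈f)

    covered-adjacent : ∀ {f c v} → M f ≡ true → incident c f ≡ true →
                       AdjLM G M c v → AdjNe G f c v
    covered-adjacent f∈M c∈f (inj₁ cv) = inj₁ cv
    covered-adjacent {c = c} f∈M c∈f (inj₂ (g , g∈M , cv))
      with refl ← matched-edge-unique {v = c} f∈M g∈M c∈f (incident-end g cv) = inj₂ cv

    AccessibleOwnEdge : Fin n → Fin n → Set
    AccessibleOwnEdge u v =
      Within2 (AdjN G) u v ⊎
      ∃ λ f → M f ≡ true × incident u f ≡ true × Within2 (AdjNe G f) u v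

    accessible-cases : ∀ {u v} → Accessible G M u v →
                       AccessibleOwnEdge u v ⊎ AccessibleOwnEdge v u
    accessible-cases (inj₁ u≡v) = inj₁ (inj₁ (inj₁ u≡v))
    accessible-cases (inj₂ (inj₁ (inj₁ uv))) = inj₁ (inj₁ (inj₂ (inj₁ uv)))
    accessible-cases (inj₂ (inj₁ (inj₂ (f , f∈M , uv)))) =
      inj₁ (inj₂ (f , f∈M , incident-end f uv , inj₂ (inj₁ (inj₂ uv))))
    accessible-cases (inj₂ (inj₂ (c , inj₁ uc , inj₁ cv))) = inj₁ (inj₁ (inj₂ (inj₂ (c , uc , cv))))
    accessible-cases (inj₂ (inj₂ (c , inj₂ (f , f∈M , uc) , cv))) =
      inj₁ (inj₂ (f , f∈M , incident-end f uc ,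
        inj₂ (inj₂ (c , inj₂ uc , covered-adjacent f∈M (incident-end f (SamePair-swap uc)) cv))))
    accessible-cases (inj₂ (inj₂ (c , inj₁ uc , inj₂ (g , g∈M , cv)))) =
      inj₂ (inj₂ (g , g∈M , incident-end g (SamePair-swap cv) ,
        Within2-sym (AdjNe-sym g) (inj₂ (inj₂ (c , inj₁ uc , inj₂ cv)))))

  module EdgeIndicator {M : State G} {xE : Fin m → ℤ}
                       (xE-incidence : ∀ e → xE e ≡ (if M e then 1ℤ else 0ℤ)) where

    ∈M⇒xE≡1 : ∀ {e} → M e ≡ true → xE e ≡ 1ℤ
    ∈M⇒xE≡1 {e} e∈M = trans (xE-incidence e) (cong (λ b → if b then 1ℤ else 0ℤ) e∈M)

    ∉M⇒xE≡0 : ∀ {e} → M e ≡ false → xE e ≡ 0ℤ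
    ∉M⇒xE≡0 {e} e∉M = trans (xE-incidence e) (cong (λ b → if b then 1ℤ else 0ℤ) e∉M)

  module FromPolytope {xE : Fin m → ℤ} {xV : Fin n → ℤ} (P : InPolytope G xE xV) where

    degree : ∀ v → degSum G xE v + xV v ≡ 1ℤ
    degree = proj₁ P

    edge-inequality : ∀ v' e u v → SamePair (ends e) (u , v) → InE u v' → v ≺[ u ] v' →
                      Within2 (AdjNe G e) u v' → worseSum G xE v' u + xV v' + xE e ≤ 1ℤ
    edge-inequality = proj₁ (proj₂ P)

    vertex-inequality : ∀ v' u → InE u v' → Within2 (AdjN G) u v' →
                        worseSum G xE v' u + xV v' + xV u ≤ 1ℤ
    vertex-inequality = proj₁ (proj₂ (proj₂ P))

    xE≥0 : ∀ e → 0ℤ ≤ xE e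
    xE≥0 = proj₁ (proj₂ (proj₂ (proj₂ P)))

    xV≥0 : ∀ v → 0ℤ ≤ xV v
    xV≥0 = proj₂ (proj₂ (proj₂ (proj₂ P)))

    degSum≤1 : ∀ v → degSum G xE v ≤ 1ℤ
    degSum≤1 v = subst (degSum G xE v ≤_) (degree v) (i≤i+j _ (xV≥0 v))

    incident⇒xE≤degSum : ∀ v {e} → incident v e ≡ true → xE e ≤ degSum G xE v
    incident⇒xE≤degSum v {e} v∈e =
      subst (_≤ degSum G xE v) (cong (λ b → if b then xE e else 0ℤ) v∈e)
        (term≤sumFin _ (λ f → if-nonneg (incident v f) (xE≥0 f)) e)

    xE≤1 : ∀ e → xE e ≤ 1ℤ
    xE≤1 e = ℤ.≤-trans (incident⇒xE≤degSum a (incident-end e (inj₁ (refl , refl)))) (degSum≤1 a)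
      where
      a : Fin n
      a = proj₁ (ends e)

    M : State G
    M e = ⌊ xE e ℤ.≟ 1ℤ ⌋

    xE-incidence : ∀ e → xE e ≡ (if M e then 1ℤ else 0ℤ)
    xE-incidence e with xE e ℤ.≟ 1ℤ | 0≤i≤1⇒i≡0⊎i≡1 (xE e) (xE≥0 e) (xE≤1 e)
    ... | yes xE≡1 | _         = xE≡1
    ... | no _     | inj₁ xE≡0 = xE≡0
    ... | no xE≢1  | inj₂ xE≡1 = ⊥-elim (xE≢1 xE≡1)

    open EdgeIndicator xE-incidence

    matching : IsMatching G M
    matching e f e∈M f∈M e≢f v v∈e with incident v f in v∈f
    ... | false = refl
    ... | true  = ⊥-elim (1≤i⇒i+1≰1 ℤ.≤-refl (ℤ.≤-trans two-edges≤degSum (degSum≤1 v)))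
      where
      two-edges≤degSum : 1ℤ + 1ℤ ≤ degSum G xE v
      two-edges≤degSum =
        subst (_≤ degSum G xE v)
          (cong₂ _+_ (trans (cong (λ b → if b then xE e else 0ℤ) v∈e) (∈M⇒xE≡1 e∈M))
                     (trans (cong (λ b → if b then xE f else 0ℤ) v∈f) (∈M⇒xE≡1 f∈M)))
          (two-terms≤sumFin _ (λ g → if-nonneg (incident v g) (xE≥0 g)) e f e≢f)

    unmatched⇒xV≡1 : ∀ {v} → Unmatched G M v → xV v ≡ 1ℤ
    unmatched⇒xV≡1 {v} unmatched = begin
      xV v                    ≡⟨ ℤ.+-identityˡ (xV v) ⟨
      0ℤ + xV v               ≡⟨ cong (_+ xV v) (sumFin-zero _ no-incident-edge) ⟨
      degSum G xE v + xV v    ≡⟨ degree v ⟩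
      1ℤ                      ∎
      where
      open ≡-Reasoning
      no-incident-edge : ∀ e → (if incident v e then xE e else 0ℤ) ≡ 0ℤ
      no-incident-edge e with incident v e in v∈e | M e in e∈M
      ... | false | _     = refl
      ... | true  | false = ∉M⇒xE≡0 e∈M
      ... | true  | true  with () ← trans (sym v∈e) (unmatched e e∈M)

    matched⇒xV≡0 : ∀ v {f} → M f ≡ true → incident v f ≡ true → xV v ≡ 0ℤ
    matched⇒xV≡0 v f∈M v∈f =
      0≤i⇒1+i≤1⇒i≡0 (xV v) (xV≥0 v)
        (subst (1ℤ + xV v ≤_) (degree v)
          (ℤ.+-monoˡ-≤ (xV v) (subst (_≤ degSum G xE v) (∈M⇒xE≡1 f∈M) (incident⇒xE≤degSum v v∈f))))

    worseSum≥0 : ∀ v u → 0ℤ ≤ worseSum G xE v u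
    worseSum≥0 v u = sumFin-nonneg _ λ e → if-nonneg (incident v e ∧ _) (xE≥0 e)

    wants⇒1≤worseSum+xV : ∀ {v u} → WantsToSwitch G M v u → 1ℤ ≤ worseSum G xE v u + xV v
    wants⇒1≤worseSum+xV {v} {u} (inj₁ unmatched) =
      subst (λ x → 1ℤ ≤ worseSum G xE v u + x) (sym (unmatched⇒xV≡1 unmatched))
        (i≤j+i 1ℤ (worseSum≥0 v u))
    wants⇒1≤worseSum+xV {v} {u} (inj₂ (g , g∈M , v∈g , worse)) =
      ℤ.≤-trans partner≤worseSum (i≤i+j _ (xV≥0 v))
      where
      partner-counted : incident v g ∧ (rank v (other g v) <ᵇ rank v u) ≡ true
      partner-counted = cong₂ _∧_ v∈g (Equivalence.to Bool.T-≡ (ℕ.<⇒<ᵇ worse))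

      partner≤worseSum : 1ℤ ≤ worseSum G xE v u
      partner≤worseSum =
        subst (_≤ worseSum G xE v u)
          (trans (cong (λ b → if b then xE g else 0ℤ) partner-counted) (∈M⇒xE≡1 g∈M))
          (term≤sumFin _ (λ e → if-nonneg (incident v e ∧ _) (xE≥0 e)) g)

    tight⇒¬wants : ∀ {v u x} → worseSum G xE v u + xV v + x ≤ 1ℤ → x ≡ 1ℤ →
                   ¬ WantsToSwitch G M v u
    tight⇒¬wants tight refl wants = 1≤i⇒i+1≰1 (wants⇒1≤worseSum+xV wants) tight

    ¬blocking-via-own-edge : ∀ {u v} → InE u v → WantsToSwitch G M u v → WantsToSwitch G M v u →
                             ¬ AccessibleOwnEdge matching u v
    ¬blocking-via-own-edge uv (inj₁ u-unmatched) v-wants (inj₁ path) =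
      tight⇒¬wants (vertex-inequality _ _ uv path) (unmatched⇒xV≡1 u-unmatched) v-wants
    ¬blocking-via-own-edge uv (inj₁ u-unmatched) v-wants (inj₂ (f , f∈M , u∈f , _))
      with () ← trans (sym u∈f) (u-unmatched f f∈M)
    ¬blocking-via-own-edge {u} {v} uv (inj₂ (f , f∈M , u∈f , worse)) v-wants access =
      tight⇒¬wants
        (edge-inequality v f u (other f u) (incident⇒SamePair f u∈f) uv worse (path access))
        (∈M⇒xE≡1 f∈M) v-wants
      where
      path : AccessibleOwnEdge matching u v → Within2 (AdjNe G f) u v
      path (inj₁ path-in-N) = Within2-map inj₁ path-in-N
      path (inj₂ (g , g∈M , u∈g , path-in-Ng))
        with refl ← matched-edge-unique matching {v = u} f∈M g∈M u∈f u∈g = path-in-Ng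

    locally-stable : LocallyStable G M
    locally-stable = matching , no-blocking-pair
      where
      no-blocking-pair : ∀ u v → ¬ LocalBlockingPair G M u v
      no-blocking-pair u v (uv , access , u-wants , v-wants) with accessible-cases matching access
      ... | inj₁ from-u = ¬blocking-via-own-edge uv u-wants v-wants from-u
      ... | inj₂ from-v = ¬blocking-via-own-edge (InE-sym uv) v-wants u-wants from-v

    incidence-vector : IsIncidenceVector G M xE xV
    incidence-vector = xE-incidence , λ v → unmatched⇒xV≡1 , ¬unmatched⇒xV≡0 v
      where
      ¬unmatched⇒xV≡0 : ∀ v → ¬ Unmatched G M v → xV v ≡ 0ℤ
      ¬unmatched⇒xV≡0 v ¬unmatched with matched⊎unmatched M v
      ... | inj₁ (f , f∈M , v∈f) = matched⇒xV≡0 v f∈M v∈f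
      ... | inj₂ unmatched       = ⊥-elim (¬unmatched unmatched)

  module FromStableMatching {M : State G} {xE : Fin m → ℤ} {xV : Fin n → ℤ}
                            (stable : LocallyStable G M)
                            (incidence : IsIncidenceVector G M xE xV) where

    open EdgeIndicator (proj₁ incidence)

    xE≥0 : ∀ e → 0ℤ ≤ xE e
    xE≥0 e with M e in e∈M
    ... | true  = subst (0ℤ ≤_) (sym (∈M⇒xE≡1 e∈M)) (+≤+ z≤n)
    ... | false = ℤ.≤-reflexive (sym (∉M⇒xE≡0 e∈M))

    unmatched⇒xV≡1 : ∀ {v} → Unmatched G M v → xV v ≡ 1ℤ
    unmatched⇒xV≡1 {v} = proj₁ (proj₂ incidence v)

    matched⇒xV≡0 : ∀ v {f} → M f ≡ true → incident v f ≡ true → xV v ≡ 0ℤ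
    matched⇒xV≡0 v f∈M v∈f =
      proj₂ (proj₂ incidence v) v-matched
      where
      v-matched : ¬ Unmatched G M v
      v-matched unmatched with () ← trans (sym v∈f) (unmatched _ f∈M)

    xV≥0 : ∀ v → 0ℤ ≤ xV v
    xV≥0 v with matched⊎unmatched M v
    ... | inj₁ (f , f∈M , v∈f) = ℤ.≤-reflexive (sym (matched⇒xV≡0 v f∈M v∈f))
    ... | inj₂ unmatched       = subst (0ℤ ≤_) (sym (unmatched⇒xV≡1 unmatched)) (+≤+ z≤n)

    incident-term≡0 : ∀ v e → (M e ≡ true → incident v e ≡ false) →
                      (if incident v e then xE e else 0ℤ) ≡ 0ℤ
    incident-term≡0 v e v∉e with M e in e∈M
    ... | true  = cong (λ b → if b then xE e else 0ℤ) (v∉e refl)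
    ... | false = if-≡0 (incident v e) (∉M⇒xE≡0 e∈M)

    degree : ∀ v → degSum G xE v + xV v ≡ 1ℤ
    degree v with matched⊎unmatched M v
    ... | inj₁ (f , f∈M , v∈f) = begin
      degSum G xE v + xV v  ≡⟨ cong₂ _+_ degSum≡xE refl ⟩
      xE f + xV v           ≡⟨ cong₂ _+_ (∈M⇒xE≡1 f∈M) (matched⇒xV≡0 v f∈M v∈f) ⟩
      1ℤ                    ∎
      where
      open ≡-Reasoning
      degSum≡xE : degSum G xE v ≡ xE f
      degSum≡xE =
        trans (sumFin-single _ f λ e e≢f →
                 incident-term≡0 v e λ e∈M → proj₁ stable f e f∈M e∈M (e≢f ∘ sym) v v∈f)
              (cong (λ b → if b then xE f else 0ℤ) v∈f)
    ... | inj₂ unmatched = begin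
      degSum G xE v + xV v  ≡⟨ cong₂ _+_ (sumFin-zero _ λ e → incident-term≡0 v e (unmatched e)) refl ⟩
      0ℤ + xV v             ≡⟨ cong (λ x → 0ℤ + x) (unmatched⇒xV≡1 {v} unmatched) ⟩
      1ℤ                    ∎
      where open ≡-Reasoning

    worseSum+xV≤1 : ∀ v u → worseSum G xE v u + xV v ≤ 1ℤ
    worseSum+xV≤1 v u =
      ℤ.≤-trans (ℤ.+-monoˡ-≤ (xV v) worseSum≤degSum) (ℤ.≤-reflexive (degree v))
      where
      worseSum≤degSum : worseSum G xE v u ≤ degSum G xE v
      worseSum≤degSum = sumFin-mono _ _ λ e → if-∧-≤ (incident v e) _ (xE≥0 e)

    ¬wants⇒worseSum+xV≡0 : ∀ {v u} → ¬ WantsToSwitch G M v u → worseSum G xE v u + xV v ≡ 0ℤ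
    ¬wants⇒worseSum+xV≡0 {v} {u} ¬wants =
      cong₂ _+_ (sumFin-zero _ worse-term≡0) (proj₂ (proj₂ incidence v) (¬wants ∘ inj₁))
      where
      worse-term≡0 : ∀ g →
        (if incident v g ∧ (rank v (other g v) <ᵇ rank v u) then xE g else 0ℤ) ≡ 0ℤ
      worse-term≡0 g with M g in g∈M | incident v g in v∈g | rank v (other g v) <ᵇ rank v u in worse
      ... | false | b     | c     = if-≡0 (b ∧ c) (∉M⇒xE≡0 g∈M)
      ... | true  | false | _     = refl
      ... | true  | true  | false = refl
      ... | true  | true  | true  =
        ⊥-elim (¬wants (inj₂ (g , g∈M , v∈g , ℕ.<ᵇ⇒< _ _ (Equivalence.from Bool.T-≡ worse))))

    extra-term-bound : ∀ {v u x} → x ≡ 0ℤ ⊎ (x ≡ 1ℤ × ¬ WantsToSwitch G M v u) →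
                       worseSum G xE v u + xV v + x ≤ 1ℤ
    extra-term-bound {v} {u} (inj₁ refl) =
      subst (_≤ 1ℤ) (sym (ℤ.+-identityʳ _)) (worseSum+xV≤1 v u)
    extra-term-bound (inj₂ (refl , ¬wants)) =
      ℤ.≤-reflexive (cong (_+ 1ℤ) (¬wants⇒worseSum+xV≡0 ¬wants))

    edge-inequality : ∀ v' e u v → SamePair (ends e) (u , v) → InE u v' → v ≺[ u ] v' →
                      Within2 (AdjNe G e) u v' → worseSum G xE v' u + xV v' + xE e ≤ 1ℤ
    edge-inequality v' e u v e=uv uv' v≺v' path with M e in e∈M
    ... | false = extra-term-bound (inj₁ (∉M⇒xE≡0 e∈M))
    ... | true  = extra-term-bound (inj₂ (∈M⇒xE≡1 e∈M , λ v'-wants →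
                    proj₂ stable u v' (uv' , Within2-map via-e path , u-wants , v'-wants)))
      where
      u-wants : WantsToSwitch G M u v'
      u-wants = inj₂ (e , e∈M , incident-end e e=uv ,
                      subst (_≺[ u ] v') (sym (other-end e e=uv)) v≺v')

      via-e : ∀ {a b} → AdjNe G e a b → AdjLM G M a b
      via-e (inj₁ ab) = inj₁ ab
      via-e (inj₂ ab) = inj₂ (e , e∈M , ab)

    vertex-inequality : ∀ v' u → InE u v' → Within2 (AdjN G) u v' →
                        worseSum G xE v' u + xV v' + xV u ≤ 1ℤ
    vertex-inequality v' u uv' path with matched⊎unmatched M u
    ... | inj₁ (f , f∈M , u∈f) = extra-term-bound (inj₁ (matched⇒xV≡0 u f∈M u∈f))
    ... | inj₂ unmatched       = extra-term-bound (inj₂ (unmatched⇒xV≡1 unmatched , λ v'-wants →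
        proj₂ stable u v' (uv' , Within2-map inj₁ path , inj₁ unmatched , v'-wants)))

    in-polytope : InPolytope G xE xV
    in-polytope = degree , edge-inequality , vertex-inequality , xE≥0 , xV≥0

proposition20 : ∀ {n m} (G : NetworkGame n m) (xE : Fin m → ℤ) (xV : Fin n → ℤ) →
    InPolytope G xE xV ⇔ (∃ λ M → LocallyStable G M × IsIncidenceVector G M xE xV)
proposition20 G xE xV = mk⇔ stable-matching polytope-point
  where
  stable-matching : InPolytope G xE xV → ∃ λ M → LocallyStable G M × IsIncidenceVector G M xE xV
  stable-matching P = M , locally-stable , incidence-vector
    where open FromPolytope G P

  polytope-point : (∃ λ M → LocallyStable G M × IsIncidenceVector G M xE xV) → InPolytope G xE xV
  polytope-point (M , stable , incidence) = FromStableMatching.in-polytope G stable incidence
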